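{- Let $T$ be a finite set of points on a circle and let $R\subseteq T^2$. Let $a,b,a',b'\in T$ be distinct points appearing in this order on the circle, such that $(a,a')\in R$ and $(b,b')\in R$. Let $R'=R\cup\{(a,b')\}$. Then $\mathsf{gen}(R)=\mathsf{gen}(R')$.
   Context: For a finite set $T$ of points on a circle and a relation $R\subseteq T^2$, $\mathsf{gen}(R)\subseteq T^2$ is defined by: $(s,t)\in\mathsf{gen}(R)$ iff for every partition of the circle into two disjoint arcs $X_s,X_t$ with $s\in X_s$ and $t\in X_t$, there exist $s'\in X_s$ and $t'\in X_t$ with $(s',t')\in R$. Arcs may be open or closed at either end. "Appear in this order on the circle" means in this cyclic order, clockwise or counterclockwise. -}

module Defs where

open import Level using (0ℓ)
open import Data.Nat using (ℕ; _+_; _∸_; _<_; _≤ᵇ_)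
open import Data.Bool using (if_then_else_)
open import Data.Fin using (Fin; toℕ)
open import Data.Product using (_×_; ∃-syntax)
open import Data.Sum using (_⊎_)
open import Relation.Binary using (Rel)
open import Relation.Binary.PropositionalEquality using (_≡_)
open import Relation.Nullary using (¬_)

-- T = {0,…,n-1} = Fin n, placed on the circle in the cyclic order 0,1,…,n-1.
-- dist i x : number of clockwise steps from i to x (in {0,…,n-1}).
dist : {n : ℕ} → Fin n → Fin n → ℕ
dist {n} i x = if toℕ i ≤ᵇ toℕ x then toℕ x ∸ toℕ i else (n + toℕ x) ∸ toℕ i

-- The trace on T of an arc of the circle: the cyclic interval of T starting
-- at i and containing the k points i, i+1, …, i+k-1 (mod n).
InArc : {n : ℕ} → Fin n → ℕ → Fin n → Set
InArc i k x = dist i x < k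

-- (s,t) ∈ gen(R): for every partition of the circle into two arcs X_s ∋ s,
-- X_t ∋ t (traced on T: a cyclic interval I with s ∈ I, t ∉ I, and its
-- complement), some s' ∈ X_s, t' ∈ X_t have (s',t') ∈ R.
gen : {n : ℕ} → Rel (Fin n) 0ℓ → Rel (Fin n) 0ℓ
gen R s t = ∀ (i : Fin _) (k : ℕ) → InArc i k s → ¬ InArc i k t →
  ∃[ s' ] ∃[ t' ] (InArc i k s' × ¬ InArc i k t' × R s' t')

-- a, b, a', b' appear in this cyclic order (clockwise or counterclockwise).
InOrder4 : {n : ℕ} → Fin n → Fin n → Fin n → Fin n → Set
InOrder4 a b a' b' =
  (dist a b < dist a a' × dist a a' < dist a b') ⊎
  (dist a b' < dist a a' × dist a a' < dist a b)

addPair : {n : ℕ} → Rel (Fin n) 0ℓ → Fin n → Fin n → Rel (Fin n) 0ℓ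
addPair R x y s t = R s t ⊎ (s ≡ x × t ≡ y)

-- Adding to R a pair that already lies in gen(R) does not change gen. And
-- (a,b') ∈ gen(R): an arc containing a but not b' either misses a', so (a,a')
-- crosses it, or contains a'; then, being an interval of the circle, it contains
-- the whole stretch from a to a' avoiding b', hence b, and (b,b') crosses it.
module Submission where

open import Defs
open import Level using (0ℓ)
open import Data.Nat using (ℕ; _+_; _∸_; _<_; _≤_; _≤?_; _<?_)
open import Data.Nat.Properties
open import Data.Fin using (Fin; toℕ)
open import Data.Fin.Properties using (toℕ-injective; toℕ<n)
open import Data.Product using (_×_; _,_; proj₂)
open import Data.Sum using (_⊎_; inj₁; inj₂)
open import Relation.Binary using (Rel; tri<; tri≈; tri>)
open import Relation.Binary.PropositionalEquality
  using (_≡_; _≢_; refl; sym; trans; subst; ≢-sym)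
open import Relation.Nullary using (¬_; yes; no; contradiction)
open import Relation.Nullary.Decidable using (dec-true; dec-false)
open import Function.Bundles using (_⇔_; mk⇔)

Cyclic : ℕ → ℕ → ℕ → Set
Cyclic x y z = (x < y × y < z) ⊎ (y < z × z < x) ⊎ (z < x × x < y)

module _ {x y z : ℕ} where

  Cyclic-rotate : Cyclic x y z → Cyclic y z x
  Cyclic-rotate (inj₁ s) = inj₂ (inj₂ s)
  Cyclic-rotate (inj₂ (inj₁ s)) = inj₁ s
  Cyclic-rotate (inj₂ (inj₂ s)) = inj₂ (inj₁ s)

  Cyclic-middle : Cyclic x y z → x < z → x < y × y < z
  Cyclic-middle (inj₁ s) _ = s
  Cyclic-middle (inj₂ (inj₁ (_ , z<x))) x<z = contradiction x<z (<-asym z<x)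
  Cyclic-middle (inj₂ (inj₂ (z<x , _))) x<z = contradiction x<z (<-asym z<x)

  sorted⇒¬Cyclic-reversed : x < y → y < z → ¬ Cyclic x z y
  sorted⇒¬Cyclic-reversed _ y<z (inj₁ (_ , z<y)) = <-asym y<z z<y
  sorted⇒¬Cyclic-reversed _ y<z (inj₂ (inj₁ (z<y , _))) = <-asym y<z z<y
  sorted⇒¬Cyclic-reversed x<y _ (inj₂ (inj₂ (y<x , _))) = <-asym x<y y<x

Cyclic-asym : ∀ {x y z} → Cyclic x y z → ¬ Cyclic x z y
Cyclic-asym (inj₁ (x<y , y<z)) c = sorted⇒¬Cyclic-reversed x<y y<z c
Cyclic-asym (inj₂ (inj₁ (y<z , z<x))) c =
  sorted⇒¬Cyclic-reversed y<z z<x (Cyclic-rotate (Cyclic-rotate c))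
Cyclic-asym (inj₂ (inj₂ (z<x , x<y))) c =
  sorted⇒¬Cyclic-reversed z<x x<y (Cyclic-rotate c)

Cyclic-total : ∀ {x y z} → x ≢ y → y ≢ z → x ≢ z → Cyclic x y z ⊎ Cyclic x z y
Cyclic-total {x} {y} {z} x≢y y≢z x≢z with <-cmp x y | <-cmp y z | <-cmp x z
... | tri≈ _ x≡y _ | _ | _ = contradiction x≡y x≢y
... | _ | tri≈ _ y≡z _ | _ = contradiction y≡z y≢z
... | _ | _ | tri≈ _ x≡z _ = contradiction x≡z x≢z
... | tri< x<y _ _ | tri< y<z _ _ | _ = inj₁ (inj₁ (x<y , y<z))
... | tri< x<y _ _ | tri> _ _ z<y | tri< x<z _ _ = inj₂ (inj₁ (x<z , z<y))
... | tri< x<y _ _ | tri> _ _ z<y | tri> _ _ z<x = inj₁ (inj₂ (inj₂ (z<x , x<y)))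
... | tri> _ _ y<x | tri< y<z _ _ | tri< x<z _ _ = inj₂ (inj₂ (inj₂ (y<x , x<z)))
... | tri> _ _ y<x | tri< y<z _ _ | tri> _ _ z<x = inj₁ (inj₂ (inj₁ (y<z , z<x)))
... | tri> _ _ y<x | tri> _ _ z<y | _ = inj₂ (inj₂ (inj₁ (z<y , y<x)))

-- An initial segment {< k} of ℕ is an arc: it cannot contain x and z but miss
-- both y and w when x, y, z, w are in cyclic order.
Cyclic-convex : ∀ {x y z w k} → Cyclic x y z → Cyclic x z w →
  x < k → z < k → ¬ w < k → y < k
Cyclic-convex c (inj₁ (x<z , _)) _ z<k _ = <-trans (proj₂ (Cyclic-middle c x<z)) z<k
Cyclic-convex c (inj₂ (inj₁ (_ , w<x))) x<k _ w≮k = contradiction (<-trans w<x x<k) w≮k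
Cyclic-convex c (inj₂ (inj₂ (_ , x<z))) _ z<k _ = <-trans (proj₂ (Cyclic-middle c x<z)) z<k

module _ {n : ℕ} where

  private
    variable
      x y z w : Fin n

    toℕ-≢ : x ≢ y → toℕ x ≢ toℕ y
    toℕ-≢ x≢y eq = x≢y (toℕ-injective eq)

  dist-≤ : ∀ i → toℕ i ≤ toℕ x → dist i x ≡ toℕ x ∸ toℕ i
  dist-≤ {x} i i≤x rewrite dec-true (toℕ i ≤? toℕ x) i≤x = refl

  dist-> : ∀ i → toℕ x < toℕ i → dist i x ≡ n + toℕ x ∸ toℕ i
  dist-> {x} i x<i rewrite dec-false (toℕ i ≤? toℕ x) (<⇒≱ x<i) = refl

  dist-self : ∀ x → dist x x ≡ 0
  dist-self x = trans (dist-≤ x ≤-refl) (n∸n≡0 (toℕ x))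

  dist-pos : x ≢ y → 0 < dist x y
  dist-pos {x} {y} x≢y with toℕ x ≤? toℕ y
  ... | yes x≤y rewrite dist-≤ x x≤y = m<n⇒0<n∸m (≤∧≢⇒< x≤y (toℕ-≢ x≢y))
  ... | no x≰y rewrite dist-> x (≰⇒> x≰y) =
    m<n⇒0<n∸m (<-≤-trans (toℕ<n x) (m≤m+n n (toℕ y)))

  dist-mono-above : ∀ i → toℕ i ≤ toℕ x → toℕ x < toℕ y → dist i x < dist i y
  dist-mono-above i i≤x x<y
    rewrite dist-≤ i i≤x | dist-≤ i (≤-trans i≤x (<⇒≤ x<y)) = ∸-monoˡ-< x<y i≤x

  dist-mono-below : ∀ i → toℕ x < toℕ y → toℕ y < toℕ i → dist i x < dist i y
  dist-mono-below {x} i x<y y<i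
    rewrite dist-> i (<-trans x<y y<i) | dist-> i y<i =
    ∸-monoˡ-< (+-monoʳ-< n x<y) (≤-trans (<⇒≤ (toℕ<n i)) (m≤m+n n (toℕ x)))

  dist-wraps : ∀ i → toℕ x < toℕ i → toℕ i ≤ toℕ y → dist i y < dist i x
  dist-wraps {x} {y} i x<i i≤y rewrite dist-> i x<i | dist-≤ i i≤y =
    ∸-monoˡ-< (<-≤-trans (toℕ<n y) (m≤m+n n (toℕ x))) i≤y

  dist-preserves-sorted : ∀ i → toℕ x < toℕ y → toℕ y < toℕ z →
    Cyclic (dist i x) (dist i y) (dist i z)
  dist-preserves-sorted {x} {y} {z} i x<y y<z
    with toℕ i ≤? toℕ x | toℕ i ≤? toℕ y | toℕ i ≤? toℕ z
  ... | yes i≤x | _ | _ =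
    inj₁ (dist-mono-above i i≤x x<y , dist-mono-above i (≤-trans i≤x (<⇒≤ x<y)) y<z)
  ... | no i≰x | yes i≤y | _ =
    inj₂ (inj₁ (dist-mono-above i i≤y y<z , dist-wraps i (≰⇒> i≰x) (≤-trans i≤y (<⇒≤ y<z))))
  ... | no i≰x | no i≰y | yes i≤z =
    inj₂ (inj₂ (dist-wraps i (≰⇒> i≰x) i≤z , dist-mono-below i x<y (≰⇒> i≰y)))
  ... | no _ | no i≰y | no i≰z =
    inj₁ (dist-mono-below i x<y (≰⇒> i≰y) , dist-mono-below i y<z (≰⇒> i≰z))

  dist-preserves-Cyclic : ∀ i → Cyclic (toℕ x) (toℕ y) (toℕ z) →
    Cyclic (dist i x) (dist i y) (dist i z)
  dist-preserves-Cyclic i (inj₁ (x<y , y<z)) = dist-preserves-sorted i x<y y<z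
  dist-preserves-Cyclic i (inj₂ (inj₁ (y<z , z<x))) =
    Cyclic-rotate (Cyclic-rotate (dist-preserves-sorted i y<z z<x))
  dist-preserves-Cyclic i (inj₂ (inj₂ (z<x , x<y))) =
    Cyclic-rotate (dist-preserves-sorted i z<x x<y)

  dist-reflects-Cyclic : ∀ i → x ≢ y → y ≢ z → x ≢ z →
    Cyclic (dist i x) (dist i y) (dist i z) → Cyclic (toℕ x) (toℕ y) (toℕ z)
  dist-reflects-Cyclic i x≢y y≢z x≢z c
    with Cyclic-total (toℕ-≢ x≢y) (toℕ-≢ y≢z) (toℕ-≢ x≢z)
  ... | inj₁ c′ = c′
  ... | inj₂ c′ = contradiction (dist-preserves-Cyclic i c′) (Cyclic-asym c)

  Cyclic-rebase : ∀ j i → x ≢ y → y ≢ z → x ≢ z →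
    Cyclic (dist j x) (dist j y) (dist j z) → Cyclic (dist i x) (dist i y) (dist i z)
  Cyclic-rebase j i x≢y y≢z x≢z c =
    dist-preserves-Cyclic i (dist-reflects-Cyclic j x≢y y≢z x≢z c)

  Cyclic-from-base : x ≢ y → dist x y < dist x z → Cyclic (dist x x) (dist x y) (dist x z)
  Cyclic-from-base {x} {y} x≢y y<z =
    inj₁ (subst (_< dist x y) (sym (dist-self x)) (dist-pos x≢y) , y<z)

  InArc-between : ∀ j i k → x ≢ y → y ≢ z → x ≢ z → z ≢ w → x ≢ w →
    Cyclic (dist j x) (dist j y) (dist j z) → Cyclic (dist j x) (dist j z) (dist j w) →
    InArc i k x → InArc i k z → ¬ InArc i k w → InArc i k y
  InArc-between j i k x≢y y≢z x≢z z≢w x≢w c₁ c₂ =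
    Cyclic-convex (Cyclic-rebase j i x≢y y≢z x≢z c₁) (Cyclic-rebase j i x≢z z≢w x≢w c₂)

gen-addPair : ∀ {n} {R : Rel (Fin n) 0ℓ} {x y} → gen R x y →
  ∀ s t → gen R s t ⇔ gen (addPair R x y) s t
gen-addPair {R = R} {x} {y} xy∈gen s t = mk⇔ to from
  where
  to : gen R s t → gen (addPair R x y) s t
  to g i k s∈ t∉ with g i k s∈ t∉
  ... | s′ , t′ , s′∈ , t′∉ , r = s′ , t′ , s′∈ , t′∉ , inj₁ r

  from : gen (addPair R x y) s t → gen R s t
  from g i k s∈ t∉ with g i k s∈ t∉
  ... | s′ , t′ , s′∈ , t′∉ , inj₁ r = s′ , t′ , s′∈ , t′∉ , r
  ... | _ , _ , x∈ , y∉ , inj₂ (refl , refl) = xy∈gen i k x∈ y∉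

lemma8 : (n : ℕ) (R : Rel (Fin n) 0ℓ) (a b a' b' : Fin n) →
    a ≢ b → a ≢ a' → a ≢ b' → b ≢ a' → b ≢ b' → a' ≢ b' →
    InOrder4 a b a' b' → R a a' → R b b' →
    (s t : Fin n) → gen R s t ⇔ gen (addPair R a b') s t
lemma8 n R a b a' b' a≢b a≢a' a≢b' b≢a' _ a'≢b' order Raa' Rbb' =
  gen-addPair ab'∈gen
  where
  b-between : InOrder4 a b a' b' →
    ∀ i k → InArc i k a → InArc i k a' → ¬ InArc i k b' → InArc i k b
  b-between (inj₁ (b<a' , a'<b')) i k a∈ a'∈ b'∉ =
    InArc-between a i k a≢b b≢a' a≢a' a'≢b' a≢b'
      (Cyclic-from-base a≢b b<a') (Cyclic-from-base a≢a' a'<b') a∈ a'∈ b'∉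
  -- In the mirrored order a, b', a', b, the points a' and a swap roles.
  b-between (inj₂ (b'<a' , a'<b)) i k a∈ a'∈ b'∉ =
    InArc-between a i k (≢-sym b≢a') (≢-sym a≢b) (≢-sym a≢a') a≢b' a'≢b'
      (Cyclic-rotate (Cyclic-from-base a≢a' a'<b))
      (Cyclic-rotate (Cyclic-rotate (Cyclic-from-base a≢b' b'<a'))) a'∈ a∈ b'∉

  ab'∈gen : gen R a b'
  ab'∈gen i k a∈ b'∉ with dist i a' <? k
  ... | no a'∉ = a , a' , a∈ , a'∉ , Raa'
  ... | yes a'∈ = b , b' , b-between order i k a∈ a'∈ b'∉ , b'∉ , Rbb'
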